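{- Let $s>2$ be an integer and let $x\in[0,1]$. Suppose that for every digit $i\in\{2,3,\ldots,s-1\}$ the frequency $\nu_i(x)$ exists and equals $0$. Then either neither the asymptotic mean of digits $r(x)$ nor the frequency $\nu_1(x)$ exists, or both exist, and in the latter case $\nu_1(x)=r(x)$.
   Context: Every $x\in[0,1]$ is written in base $s$ as $x=\sum_{n\ge1}\alpha_n s^{ -n}$ with digits $\alpha_n=\alpha_n(x)\in\{0,1,\ldots,s-1\}$; for $s$-adic rational numbers (which have two representations) one always uses the representation ending in the period $(0)$, so that $\alpha_n(x)$ is a well-defined function on $[0,1]$. $N_i(x,k)=\#\{j\le k:\alpha_j(x)=i\}$. The frequency of the digit $i$ is $\nu_i(x)=\lim_{k\to\infty}N_i(x,k)/k$ (when the limit exists). The asymptotic mean of digits is $r(x)=\lim_{n\to\infty}\frac1n\sum_{j=1}^n\alpha_j(x)$ (when the limit exists). -}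

module Defs where

open import Data.Nat using (ℕ; zero; suc; _+_; _≡ᵇ_; _≥_; _∸_)
open import Data.Bool using (if_then_else_)
open import Data.Fin using (Fin; toℕ)
open import Data.Integer using (+_)
open import Data.Rational using (ℚ; _/_; _-_; ∣_∣; _<_; 0ℚ)
open import Data.Product using (∃)
open import Relation.Binary.PropositionalEquality using (_≡_)
open import Relation.Nullary using (¬_)

-- A point x ∈ [0,1] is represented by its base-s digit sequence
-- α : ℕ → Fin s, where α j is the digit α_{j+1}(x).

count : {s : ℕ} → (ℕ → Fin s) → ℕ → ℕ → ℕ
count α i zero = 0
count α i (suc k) = count α i k + (if toℕ (α k) ≡ᵇ i then 1 else 0)

digitSum : {s : ℕ} → (ℕ → Fin s) → ℕ → ℕ
digitSum α zero = 0
digitSum α (suc k) = digitSum α k + toℕ (α k)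

-- k-th term (k ≥ 1, indexed as k = n+1) of N_i(x,k)/k
freqSeq : {s : ℕ} → (ℕ → Fin s) → ℕ → ℕ → ℚ
freqSeq α i n = (+ count α i (suc n)) / suc n

meanSeq : {s : ℕ} → (ℕ → Fin s) → ℕ → ℚ
meanSeq α n = (+ digitSum α (suc n)) / suc n

ConvergesTo : (ℕ → ℚ) → ℚ → Set
ConvergesTo a L = ∀ (ε : ℚ) → 0ℚ < ε → ∃ λ M → ∀ n → n ≥ M → ∣ a n - L ∣ < ε

-- lim a_n exists (as a real number): a is Cauchy
Converges : (ℕ → ℚ) → Set
Converges a = ∀ (ε : ℚ) → 0ℚ < ε → ∃ λ M → ∀ m n → m ≥ M → n ≥ M → ∣ a m - a n ∣ < ε

SameLimit : (ℕ → ℚ) → (ℕ → ℚ) → Set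
SameLimit a b = ConvergesTo (λ n → a n - b n) 0ℚ

-- the convention: the expansion does not end in the period (s-1)
NotEventuallyTop : {s : ℕ} → (ℕ → Fin s) → Set
NotEventuallyTop {s} α = ¬ (∃ λ M → ∀ n → n ≥ M → toℕ (α n) ≡ s ∸ 1)

-- Write N₁(k) for the number of ones and H(k) for the number of digits ≥ 2 among the first k
-- digits. Each digit v satisfies [v = 1] ≤ v ≤ [v = 1] + (s − 1)[v ≥ 2], so summing,
-- N₁(k) ≤ α₁ + ⋯ + α_k ≤ N₁(k) + (s − 1) H(k). Since H(k) = Σ_{i=2}^{s−1} N_i(k), the
-- hypothesis gives H(k)/k → 0, hence (α₁ + ⋯ + α_k)/k − N₁(k)/k → 0; so the two sequences
-- converge together and to the same limit.

module Submission where

open import Defs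
import Algebra.Properties.CommutativeSemigroup
open import Data.Bool using (if_then_else_)
open import Data.Fin using (Fin; toℕ)
import Data.Fin.Properties as Fin
open import Data.Integer as ℤ using (+_)
import Data.Integer.Properties as ℤP
open import Data.Integer.Tactic.RingSolver using (solve-∀)
open import Data.Nat as ℕ using (ℕ; zero; suc; _+_; _*_; _∸_; _⊔_; _≡ᵇ_; _<_; _≤_; _≥_; z≤n; s≤s)
import Data.Nat.Properties as ℕP
open import Data.Product using (_×_; ∃; _,_)
open import Data.Rational as ℚ using (ℚ; 0ℚ; ½; ∣_∣; toℚᵘ; _/_)
import Data.Rational.Properties as ℚP
open import Data.Rational.Solver using (module +-*-Solver)
import Data.Rational.Unnormalised as ℚᵘ
import Data.Rational.Unnormalised.Properties as ℚᵘP
open import Data.Sum using (inj₁; inj₂)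
open import Function using (_∘_)
open import Function.Bundles using (_⇔_; mk⇔)
open import Relation.Binary.PropositionalEquality

open import Algebra.Definitions.RawMonoid ℚ.+-0-rawMonoid using () renaming (_×_ to _·_)
open Algebra.Properties.CommutativeSemigroup ℕP.+-commutativeSemigroup using (interchange)
open +-*-Solver using (solve; _:+_; _:-_; _:*_; :-_; _:=_; con)

m<o∸n⇒n+m<o : ∀ {m} n {o} → m < o ∸ n → n + m < o
m<o∸n⇒n+m<o zero m<o = m<o
m<o∸n⇒n+m<o (suc n) {suc o} m<o∸n = s≤s (m<o∸n⇒n+m<o n m<o∸n)

infix 5 ∑<
∑< : ℕ → (ℕ → ℕ) → ℕ
∑< zero f = 0
∑< (suc k) f = ∑< k f + f k

syntax ∑< k (λ j → e) = ∑[ j < k ] e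

module _ {f g : ℕ → ℕ} where

  ∑<-mono-≤ : (∀ j → f j ≤ g j) → ∀ k → ∑< k f ≤ ∑< k g
  ∑<-mono-≤ f≤g zero = z≤n
  ∑<-mono-≤ f≤g (suc k) = ℕP.+-mono-≤ (∑<-mono-≤ f≤g k) (f≤g k)

  ∑<-distrib-+ : ∀ k → ∑[ j < k ] (f j + g j) ≡ ∑< k f + ∑< k g
  ∑<-distrib-+ zero = refl
  ∑<-distrib-+ (suc k) = begin
    (∑[ j < k ] (f j + g j)) + (f k + g k)  ≡⟨ cong (_+ (f k + g k)) (∑<-distrib-+ k) ⟩
    (∑< k f + ∑< k g) + (f k + g k)         ≡⟨ interchange (∑< k f) (∑< k g) (f k) (g k) ⟩
    ∑< (suc k) f + ∑< (suc k) g             ∎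
    where open ≡-Reasoning

∑<-cong : ∀ {f g : ℕ → ℕ} → (∀ j → f j ≡ g j) → ∀ k → ∑< k f ≡ ∑< k g
∑<-cong f≡g zero = refl
∑<-cong f≡g (suc k) = cong₂ _+_ (∑<-cong f≡g k) (f≡g k)

∑<-distribˡ-* : ∀ c (f : ℕ → ℕ) k → ∑[ j < k ] (c * f j) ≡ c * ∑< k f
∑<-distribˡ-* c f zero = sym (ℕP.*-zeroʳ c)
∑<-distribˡ-* c f (suc k) = trans (cong (_+ c * f k) (∑<-distribˡ-* c f k))
                                  (sym (ℕP.*-distribˡ-+ c (∑< k f) (f k)))

∑<-comm : ∀ (f : ℕ → ℕ → ℕ) k l → ∑[ i < k ] ∑[ j < l ] f i j ≡ ∑[ j < l ] ∑[ i < k ] f i j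
∑<-comm f zero l = sym (∑<-zero l)
  where
  ∑<-zero : ∀ l → ∑[ j < l ] 0 ≡ 0
  ∑<-zero zero = refl
  ∑<-zero (suc l) = cong (_+ 0) (∑<-zero l)
∑<-comm f (suc k) l = trans (cong (_+ (∑[ j < l ] f k j)) (∑<-comm f k l))
                            (sym (∑<-distrib-+ l))

term≤∑< : ∀ (f : ℕ → ℕ) {j k} → j < k → f j ≤ ∑< k f
term≤∑< f {j} {suc k} j<1+k with ℕP.m≤n⇒m<n∨m≡n (ℕP.≤-pred j<1+k)
... | inj₁ j<k = ℕP.≤-trans (term≤∑< f j<k) (ℕP.m≤m+n (∑< k f) (f k))
... | inj₂ refl = ℕP.m≤n+m (f k) (∑< k f)

δ : ℕ → ℕ → ℕ
δ v i = if v ≡ᵇ i then 1 else 0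

δ-refl : ∀ v → δ v v ≡ 1
δ-refl zero = refl
δ-refl (suc v) = δ-refl v

δ-1≤ : ∀ v → δ v 1 ≤ v
δ-1≤ zero = z≤n
δ-1≤ (suc zero) = s≤s z≤n
δ-1≤ (suc (suc v)) = z≤n

digit≤ : ∀ {s} v → v < s → v ≤ δ v 1 + (s ∸ 1) * (∑[ i < s ∸ 2 ] δ v (2 + i))
digit≤ zero _ = z≤n
digit≤ (suc zero) _ = s≤s z≤n
digit≤ {suc (suc s)} v@(suc (suc w)) (s≤s (s≤s w<s)) = begin
  v                         ≤⟨ s≤s w<s ⟩
  suc s                     ≡⟨ ℕP.*-identityʳ (suc s) ⟨
  suc s * 1                 ≤⟨ ℕP.*-monoʳ-≤ (suc s) 1≤H ⟩
  suc s * H                 ∎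
  where
  open ℕP.≤-Reasoning
  H = ∑[ i < s ] δ v (2 + i)
  1≤H : 1 ≤ H
  1≤H = subst (_≤ H) (δ-refl v) (term≤∑< (λ i → δ v (2 + i)) w<s)

module _ {s} (α : ℕ → Fin s) where

  count≡∑< : ∀ i k → count α i k ≡ ∑[ j < k ] δ (toℕ (α j)) i
  count≡∑< i zero = refl
  count≡∑< i (suc k) = cong (_+ δ (toℕ (α k)) i) (count≡∑< i k)

  digitSum≡∑< : ∀ k → digitSum α k ≡ ∑[ j < k ] toℕ (α j)
  digitSum≡∑< zero = refl
  digitSum≡∑< (suc k) = cong (_+ toℕ (α k)) (digitSum≡∑< k)

  highCount : ℕ → ℕ
  highCount k = ∑[ i < s ∸ 2 ] count α (2 + i) k

  count-1≤digitSum : ∀ k → count α 1 k ≤ digitSum α k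
  count-1≤digitSum k = begin
    count α 1 k                  ≡⟨ count≡∑< 1 k ⟩
    ∑[ j < k ] δ (toℕ (α j)) 1   ≤⟨ ∑<-mono-≤ (δ-1≤ ∘ toℕ ∘ α) k ⟩
    ∑[ j < k ] toℕ (α j)         ≡⟨ digitSum≡∑< k ⟨
    digitSum α k                 ∎
    where open ℕP.≤-Reasoning

  digitSum≤count-1+highCount : ∀ k → digitSum α k ≤ count α 1 k + (s ∸ 1) * highCount k
  digitSum≤count-1+highCount k = begin
    digitSum α k                                  ≡⟨ digitSum≡∑< k ⟩
    ∑[ j < k ] toℕ (α j)                          ≤⟨ ∑<-mono-≤ (λ j → digit≤ (a j) (Fin.toℕ<n (α j))) k ⟩
    ∑[ j < k ] (δ (a j) 1 + (s ∸ 1) * high j)     ≡⟨ ∑<-distrib-+ k ⟩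
    (∑[ j < k ] δ (a j) 1) + (∑[ j < k ] (s ∸ 1) * high j)
      ≡⟨ cong₂ _+_ (sym (count≡∑< 1 k)) (∑<-distribˡ-* (s ∸ 1) high k) ⟩
    count α 1 k + (s ∸ 1) * (∑[ j < k ] high j)
      ≡⟨ cong (λ h → count α 1 k + (s ∸ 1) * h) (∑<-comm (λ j i → δ (a j) (2 + i)) k (s ∸ 2)) ⟩
    count α 1 k + (s ∸ 1) * (∑[ i < s ∸ 2 ] ∑[ j < k ] δ (a j) (2 + i))
      ≡⟨ cong (λ h → count α 1 k + (s ∸ 1) * h) (∑<-cong (λ i → sym (count≡∑< (2 + i) k)) (s ∸ 2)) ⟩
    count α 1 k + (s ∸ 1) * highCount k           ∎
    where
    open ℕP.≤-Reasoning
    a : ℕ → ℕ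
    a j = toℕ (α j)
    high : ℕ → ℕ
    high j = ∑[ i < s ∸ 2 ] δ (a j) (2 + i)

Null : (ℕ → ℚ) → Set
Null a = ConvergesTo a 0ℚ

module _ {a : ℕ → ℚ} where

  null-intro : (∀ ε → 0ℚ ℚ.< ε → ∃ λ M → ∀ n → n ≥ M → ∣ a n ∣ ℚ.< ε) → Null a
  null-intro h ε ε>0 with h ε ε>0
  ... | M , small = M , λ n n≥M → subst (λ x → ∣ x ∣ ℚ.< ε) (sym (ℚP.+-identityʳ (a n))) (small n n≥M)

  null-elim : Null a → ∀ ε → 0ℚ ℚ.< ε → ∃ λ M → ∀ n → n ≥ M → ∣ a n ∣ ℚ.< ε
  null-elim na ε ε>0 with na ε ε>0
  ... | M , small = M , λ n n≥M → subst (λ x → ∣ x ∣ ℚ.< ε) (ℚP.+-identityʳ (a n)) (small n n≥M)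

½*-pos : ∀ {ε} → 0ℚ ℚ.< ε → 0ℚ ℚ.< ½ ℚ.* ε
½*-pos {ε} ε>0 = subst (ℚ._< ½ ℚ.* ε) (ℚP.*-zeroʳ ½) (ℚP.*-monoʳ-<-pos ½ ε>0)

+-<-halves : ∀ {x y ε} → x ℚ.< ½ ℚ.* ε → y ℚ.< ½ ℚ.* ε → x ℚ.+ y ℚ.< ε
+-<-halves {ε = ε} x< y< = subst (_ ℚ.<_) (halves ε) (ℚP.+-mono-< x< y<)
  where
  halves : ∀ ε → ½ ℚ.* ε ℚ.+ ½ ℚ.* ε ≡ ε
  halves = solve 1 (λ e → con ½ :* e :+ con ½ :* e := e) refl

null-cong : ∀ {a b : ℕ → ℚ} → (∀ n → a n ≡ b n) → Null a → Null b
null-cong {a} {b} a≡b na ε ε>0 with na ε ε>0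
... | M , small = M , λ n n≥M → subst (λ x → ∣ x ℚ.- 0ℚ ∣ ℚ.< ε) (a≡b n) (small n n≥M)

null-0 : Null (λ _ → 0ℚ)
null-0 ε ε>0 = 0 , λ _ _ → ε>0

null-+ : ∀ {a b : ℕ → ℚ} → Null a → Null b → Null (λ n → a n ℚ.+ b n)
null-+ {a} {b} na nb = null-intro λ ε ε>0 →
  let M₁ , small₁ = null-elim {a} na (½ ℚ.* ε) (½*-pos ε>0)
      M₂ , small₂ = null-elim {b} nb (½ ℚ.* ε) (½*-pos ε>0)
  in M₁ ⊔ M₂ , λ n n≥M → ℚP.≤-<-trans (ℚP.∣p+q∣≤∣p∣+∣q∣ (a n) (b n))
       (+-<-halves (small₁ n (ℕP.m⊔n≤o⇒m≤o M₁ M₂ n≥M)) (small₂ n (ℕP.m⊔n≤o⇒n≤o M₁ M₂ n≥M)))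

null-· : ∀ c {a : ℕ → ℚ} → Null a → Null (λ n → c · a n)
null-· zero na = null-0
null-· (suc c) {a} na = null-+ {a} {λ n → c · a n} na (null-· c na)

null-neg : ∀ {a : ℕ → ℚ} → Null a → Null (λ n → ℚ.- a n)
null-neg {a} na = null-intro λ ε ε>0 →
  let M , small = null-elim {a} na ε ε>0
  in M , λ n n≥M → subst (ℚ._< ε) (sym (ℚP.∣-p∣≡∣p∣ (a n))) (small n n≥M)

null-squeeze : ∀ {a b : ℕ → ℚ} → (∀ n → 0ℚ ℚ.≤ b n) → (∀ n → b n ℚ.≤ a n) → Null a → Null b
null-squeeze {a} {b} b≥0 b≤a na = null-intro λ ε ε>0 →
  let M , small = null-elim {a} na ε ε>0
  in M , λ n n≥M → subst (ℚ._< ε) (sym (ℚP.0≤p⇒∣p∣≡p (b≥0 n)))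
       (ℚP.≤-<-trans (b≤a n) (subst (ℚ._< ε) (ℚP.0≤p⇒∣p∣≡p (a≥0 n)) (small n n≥M)))
  where
  a≥0 : ∀ n → 0ℚ ℚ.≤ a n
  a≥0 n = ℚP.≤-trans (b≥0 n) (b≤a n)

null⇒converges : ∀ {a : ℕ → ℚ} → Null a → Converges a
null⇒converges {a} na ε ε>0 =
  let M , small = null-elim {a} na (½ ℚ.* ε) (½*-pos ε>0)
  in M , λ m n m≥M n≥M → ℚP.≤-<-trans (ℚP.∣p-q∣≤∣p∣+∣q∣ (a m) (a n))
       (+-<-halves (small m m≥M) (small n n≥M))

converges-+ : ∀ {a b : ℕ → ℚ} → Converges a → Converges b → Converges (λ n → a n ℚ.+ b n)
converges-+ {a} {b} ca cb ε ε>0 =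
  let M₁ , close₁ = ca (½ ℚ.* ε) (½*-pos ε>0)
      M₂ , close₂ = cb (½ ℚ.* ε) (½*-pos ε>0)
  in M₁ ⊔ M₂ , λ m n m≥M n≥M →
       subst (λ x → ∣ x ∣ ℚ.< ε) (sym (rearrange (a m) (b m) (a n) (b n)))
         (ℚP.≤-<-trans (ℚP.∣p+q∣≤∣p∣+∣q∣ (a m ℚ.- a n) (b m ℚ.- b n))
           (+-<-halves (close₁ m n (ℕP.m⊔n≤o⇒m≤o M₁ M₂ m≥M) (ℕP.m⊔n≤o⇒m≤o M₁ M₂ n≥M))
                       (close₂ m n (ℕP.m⊔n≤o⇒n≤o M₁ M₂ m≥M) (ℕP.m⊔n≤o⇒n≤o M₁ M₂ n≥M))))
  where
  rearrange : ∀ x y z w → (x ℚ.+ y) ℚ.- (z ℚ.+ w) ≡ (x ℚ.- z) ℚ.+ (y ℚ.- w)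
  rearrange = solve 4 (λ x y z w → (x :+ y) :- (z :+ w) := (x :- z) :+ (y :- w)) refl

converges-cong : ∀ {a b : ℕ → ℚ} → (∀ n → a n ≡ b n) → Converges a → Converges b
converges-cong {a} {b} a≡b ca ε ε>0 with ca ε ε>0
... | M , close = M , λ m n m≥M n≥M →
  subst₂ (λ x y → ∣ x ℚ.- y ∣ ℚ.< ε) (a≡b m) (a≡b n) (close m n m≥M n≥M)

null-difference⇒converges-⇔ : ∀ {a b : ℕ → ℚ} → Null (λ n → a n ℚ.- b n) → Converges a ⇔ Converges b
null-difference⇒converges-⇔ {a} {b} null-a-b = mk⇔ (transfer {a} {b} null-b-a) (transfer {b} {a} null-a-b)
  where
  transfer : ∀ {c d : ℕ → ℚ} → Null (λ n → d n ℚ.- c n) → Converges c → Converges d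
  transfer {c} {d} null-d-c cc = converges-cong (λ n → c+[d-c]≡d (d n) (c n))
    (converges-+ {c} cc (null⇒converges {λ n → d n ℚ.- c n} null-d-c))
    where
    c+[d-c]≡d : ∀ x y → y ℚ.+ (x ℚ.- y) ≡ x
    c+[d-c]≡d = solve 2 (λ x y → y :+ (x :- y) := x) refl
  null-b-a : Null (λ n → b n ℚ.- a n)
  null-b-a = null-cong (λ n → neg-[x-y] (a n) (b n)) (null-neg {λ n → a n ℚ.- b n} null-a-b)
    where
    neg-[x-y] : ∀ x y → ℚ.- (x ℚ.- y) ≡ y ℚ.- x
    neg-[x-y] = solve 2 (λ x y → :- (x :- y) := y :- x) refl

-- freqSeq α i and meanSeq α are definitionally average (count α i) and average (digitSum α).
average : (ℕ → ℕ) → ℕ → ℚ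
average f n = + f (suc n) / suc n

module _ (n : ℕ) where

  private
    toℚᵘ-/ : ∀ a → toℚᵘ (+ a / suc n) ℚᵘ.≃ ℚᵘ.mkℚᵘ (+ a) n
    toℚᵘ-/ a = ℚP.toℚᵘ-fromℚᵘ (ℚᵘ.mkℚᵘ (+ a) n)

  /-mono-≤ : ∀ {a b} → a ≤ b → + a / suc n ℚ.≤ + b / suc n
  /-mono-≤ {a} {b} a≤b = ℚP.toℚᵘ-cancel-≤
    (ℚᵘP.≤-respˡ-≃ (ℚᵘP.≃-sym (toℚᵘ-/ a))
      (ℚᵘP.≤-respʳ-≃ (ℚᵘP.≃-sym (toℚᵘ-/ b)) (ℚᵘ.*≤* cross)))
    where
    cross : + a ℤ.* + suc n ℤ.≤ + b ℤ.* + suc n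
    cross = subst₂ ℤ._≤_ (ℤP.pos-* a (suc n)) (ℤP.pos-* b (suc n)) (ℤ.+≤+ (ℕP.*-monoˡ-≤ (suc n) a≤b))

  /-distrib-+ : ∀ a b → + (a + b) / suc n ≡ + a / suc n ℚ.+ + b / suc n
  /-distrib-+ a b = ℚP.toℚᵘ-injective
    (ℚᵘP.≃-trans (toℚᵘ-/ (a + b)) (ℚᵘP.≃-trans sameDenominator (ℚᵘP.≃-sym toℚᵘ-sum)))
    where
    toℚᵘ-sum : toℚᵘ (+ a / suc n ℚ.+ + b / suc n) ℚᵘ.≃ ℚᵘ.mkℚᵘ (+ a) n ℚᵘ.+ ℚᵘ.mkℚᵘ (+ b) n
    toℚᵘ-sum = ℚᵘP.≃-trans (ℚP.toℚᵘ-homo-+ (+ a / suc n) (+ b / suc n)) (ℚᵘP.+-cong (toℚᵘ-/ a) (toℚᵘ-/ b))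
    d = + suc n
    sameDenominator : ℚᵘ.mkℚᵘ (+ (a + b)) n ℚᵘ.≃ ℚᵘ.mkℚᵘ (+ a) n ℚᵘ.+ ℚᵘ.mkℚᵘ (+ b) n
    sameDenominator = ℚᵘ.*≡* (begin
        + (a + b) ℤ.* + (suc n * suc n)     ≡⟨ cong₂ ℤ._*_ (ℤP.pos-+ a b) (ℤP.pos-* (suc n) (suc n)) ⟩
        (+ a ℤ.+ + b) ℤ.* (d ℤ.* d)         ≡⟨ distrib (+ a) (+ b) d ⟩
        (+ a ℤ.* d ℤ.+ + b ℤ.* d) ℤ.* d     ∎)
      where
      open ≡-Reasoning
      distrib : ∀ x y z → (x ℤ.+ y) ℤ.* (z ℤ.* z) ≡ (x ℤ.* z ℤ.+ y ℤ.* z) ℤ.* z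
      distrib = solve-∀

module _ {f g : ℕ → ℕ} where

  average-mono-≤ : (∀ k → f k ≤ g k) → ∀ n → average f n ℚ.≤ average g n
  average-mono-≤ f≤g n = /-mono-≤ n (f≤g (suc n))

  average-+ : ∀ n → average (λ k → f k + g k) n ≡ average f n ℚ.+ average g n
  average-+ n = /-distrib-+ n (f (suc n)) (g (suc n))

  average-∸ : (∀ k → g k ≤ f k) → ∀ n → average (λ k → f k ∸ g k) n ≡ average f n ℚ.- average g n
  average-∸ g≤f n = begin
    average f∸g n                                    ≡⟨ x≡[x+y]-y (average f∸g n) (average g n) ⟩
    (average f∸g n ℚ.+ average g n) ℚ.- average g n  ≡⟨ cong (ℚ._- average g n) split ⟨
    average f n ℚ.- average g n                      ∎
    where
    open ≡-Reasoning
    f∸g : ℕ → ℕ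
    f∸g k = f k ∸ g k
    split : average f n ≡ average f∸g n ℚ.+ average g n
    split = trans (cong (λ a → + a / suc n) (sym (ℕP.m∸n+n≡m (g≤f (suc n)))))
                  (/-distrib-+ n (f∸g (suc n)) (g (suc n)))
    x≡[x+y]-y : ∀ x y → x ≡ (x ℚ.+ y) ℚ.- y
    x≡[x+y]-y = solve 2 (λ x y → x := (x :+ y) :- y) refl

average-0 : ∀ n → average (λ _ → 0) n ≡ 0ℚ
average-0 n = ℚP.0/n≡0 (suc n)

average-nonNeg : ∀ f n → 0ℚ ℚ.≤ average f n
average-nonNeg f n = subst (ℚ._≤ average f n) (average-0 n) (average-mono-≤ {λ _ → 0} {f} (λ _ → z≤n) n)

average-* : ∀ c f n → average (λ k → c * f k) n ≡ c · average f n
average-* zero f n = average-0 n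
average-* (suc c) f n = trans (average-+ {f} {λ k → c * f k} n) (cong (average f n ℚ.+_) (average-* c f n))

null-average-mono : ∀ {f g} → (∀ k → g k ≤ f k) → Null (average f) → Null (average g)
null-average-mono {f} {g} g≤f = null-squeeze (average-nonNeg g) (average-mono-≤ g≤f)

null-average-* : ∀ c {f} → Null (average f) → Null (average (λ k → c * f k))
null-average-* c {f} null-f = null-cong (λ n → sym (average-* c f n)) (null-· c null-f)

null-average-∑< : ∀ (f : ℕ → ℕ → ℕ) m → (∀ i → i < m → Null (average (f i))) →
                  Null (average (λ k → ∑[ i < m ] f i k))
null-average-∑< f zero _ = null-cong (λ n → sym (average-0 n)) null-0
null-average-∑< f (suc m) null-f = null-cong (λ n → sym (average-+ {∑m} {f m} n))
  (null-+ {average ∑m} {average (f m)} (null-average-∑< f m (λ i i<m → null-f i (ℕP.m<n⇒m<1+n i<m)))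
                                       (null-f m ℕP.≤-refl))
  where
  ∑m : ℕ → ℕ
  ∑m k = ∑[ i < m ] f i k

mean-freq-1-sameLimit : ∀ {s} (α : ℕ → Fin s) → (∀ i → 2 ≤ i → i < s → Null (freqSeq α i)) →
                        SameLimit (meanSeq α) (freqSeq α 1)
mean-freq-1-sameLimit {s} α null-freq =
  null-cong (average-∸ (count-1≤digitSum α))
    (null-average-mono {λ k → (s ∸ 1) * highCount α k} excess≤ (null-average-* (s ∸ 1) {highCount α} null-high))
  where
  excess≤ : ∀ k → digitSum α k ∸ count α 1 k ≤ (s ∸ 1) * highCount α k
  excess≤ k = ℕP.m≤n+o⇒m∸n≤o (digitSum α k) (count α 1 k) (digitSum≤count-1+highCount α k)
  null-high : Null (average (highCount α))
  null-high = null-average-∑< (λ i → count α (2 + i)) (s ∸ 2)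
    (λ i i<s∸2 → null-freq (2 + i) (s≤s (s≤s z≤n)) (m<o∸n⇒n+m<o 2 i<s∸2))

-- Neither s > 2 nor the convention on the expansion is needed.
lemma1 : (s : ℕ) → 2 < s → (α : ℕ → Fin s) → NotEventuallyTop α →
         (∀ (i : ℕ) → 2 ≤ i → i < s → ConvergesTo (freqSeq α i) 0ℚ) →
         (Converges (meanSeq α) ⇔ Converges (freqSeq α 1)) ×
         (Converges (meanSeq α) → Converges (freqSeq α 1) → SameLimit (meanSeq α) (freqSeq α 1))
lemma1 s _ α _ null-freq = null-difference⇒converges-⇔ {meanSeq α} {freqSeq α 1} sameLimit , λ _ _ → sameLimit
  where
  sameLimit : SameLimit (meanSeq α) (freqSeq α 1)
  sameLimit = mean-freq-1-sameLimit α null-freq
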